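{- There exist constants $c>0$ and $n_0$ such that for every $n\ge n_0$ there exists a graph $G$ on $n$ vertices with at least $c\,n\frac{\log n}{\log\log n}$ edges whose separation dimension is at most $6$.
   Context: For points $x,y\in\mathbb{R}^d$, let $b(x,y)$ denote the closed axis-parallel box spanned by $x$ and $y$. The separation dimension of a graph $G$ is the smallest $d$ for which there is a map $\phi:V(G)\to\mathbb{R}^d$ such that whenever $\{x,y\}$ and $\{x',y'\}$ are disjoint edges of $G$, the boxes $b(\phi(x),\phi(y))$ and $b(\phi(x'),\phi(y'))$ are disjoint. -}

module Defs where

open import Data.Nat using (ℕ; _<_)
open import Data.Fin using (Fin; toℕ)
open import Data.Product using (_×_; _,_; Σ; ∃; proj₁; proj₂)
open import Data.List using (List; length)
open import Data.List.Membership.Propositional using (_∈_)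
open import Data.List.Relation.Unary.All using (All)
open import Data.List.Relation.Unary.Unique.Propositional using (Unique)
open import Data.Rational using (ℚ; _≤_; _⊓_; _⊔_)
open import Relation.Binary.PropositionalEquality using (_≡_; _≢_)
open import Relation.Nullary using (¬_)

record Graph (n : ℕ) : Set where
  field
    edges   : List (Fin n × Fin n)
    ordered : All (λ e → toℕ (proj₁ e) < toℕ (proj₂ e)) edges
    unique  : Unique edges

open Graph public

numEdges : ∀ {n} → Graph n → ℕ
numEdges G = length (edges G)

-- Points of Q^d (rational coordinates stand in for real ones).
Point : ℕ → Set
Point d = Fin d → ℚ

InBox : ∀ {d} → Point d → Point d → Point d → Set
InBox x y z = ∀ i → ((x i ⊓ y i) ≤ z i) × (z i ≤ (x i ⊔ y i))

BoxesDisjoint : ∀ {d} → Point d → Point d → Point d → Point d → Set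
BoxesDisjoint x y x' y' = ¬ (Σ (Point _) λ z → InBox x y z × InBox x' y' z)

EdgesDisjoint : ∀ {n} → Fin n × Fin n → Fin n × Fin n → Set
EdgesDisjoint (u , v) (u' , v') = u ≢ u' × u ≢ v' × v ≢ u' × v ≢ v'

Separating : ∀ {n} (G : Graph n) (d : ℕ) → (Fin n → Point d) → Set
Separating G d φ =
  ∀ {e e'} → e ∈ edges G → e' ∈ edges G → EdgesDisjoint e e' →
  BoxesDisjoint (φ (proj₁ e)) (φ (proj₂ e)) (φ (proj₁ e')) (φ (proj₂ e'))

SepDimAtMost : ∀ {n} → Graph n → ℕ → Set
SepDimAtMost {n} G d = Σ (Fin n → Point d) (Separating G d)

-- Take the incidence graph between the points of a grid [q] × [t]^k and its
-- axis-parallel lines in the k directions of radix t.  A point has a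
-- lexicographic and a colexicographic rank; a line, whose points agree before
-- and after its direction, gets a box of such rank pairs that contains the
-- ranks of its own points and of no other point.  Placing every vertex at the
-- lower and upper corners of its box (degenerate for a point) separates two
-- disjoint edges pℓ, p'ℓ' in some coordinate unless p lies on ℓ' and p' on ℓ,
-- which is impossible as two distinct points share at most one line.  With
-- t = 2^s ≈ log n, k ≈ log n / 2s and q ≈ n / 2t^k the grid has between n/4
-- and n/2 points, each on k lines.

module Submission where

open import Defs
open import Data.Nat using (ℕ; _*_; _≤_; _≥_)
open import Data.Nat.Logarithm using (⌊log₂_⌋)
open import Data.Product using (Σ; _×_)

open import Data.Nat as ℕ
  using (zero; suc; _+_; _^_; _∸_; _<_; _<?_; _≤?_; _⊔_; _⊓_; ⌊_/2⌋; ⌈_/2⌉; pred;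
         NonZero; >-nonZero; >-nonZero⁻¹; z≤n; s≤s; s≤s⁻¹)
open import Data.Nat.Properties
open import Data.Nat.DivMod using (_/_; _%_; m≥n⇒m/n>0; m/n*n≤m; m≡m%n+[m/n]*n; m%n<n)
open import Data.Nat.Logarithm using (⌊log₂⌋-mono-≤; ⌊log₂[2^n]⌋≡n; ⌊log₂⌊n/2⌋⌋≡⌊log₂n⌋∸1)
open import Data.Nat.Tactic.RingSolver using (solve-∀)
open import Algebra.Properties.CommutativeSemigroup *-commutativeSemigroup using (x∙yz≈y∙xz)
open import Data.Fin as Fin
  using (Fin; toℕ; fromℕ<; combine; remQuot; splitAt; _↑ˡ_; _↑ʳ_; inject≤)
open import Data.Fin.Properties
  using (toℕ<n; toℕ-injective; toℕ-fromℕ<; toℕ-↑ˡ; toℕ-↑ʳ; ↑ˡ-injective; ↑ʳ-injective;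
         splitAt-↑ˡ; splitAt-↑ʳ; toℕ-combine; combine-injectiveˡ; remQuot-combine;
         combine-remQuot; toℕ-inject≤; inject≤-injective; all?; ¬∀⟶∃¬)
open import Data.List using (List; []; _∷_; replicate; map; tabulate)
open import Data.List.Properties using (∷-injective; length-map; length-tabulate)
open import Data.List.Membership.Propositional using (_∈_)
open import Data.List.Membership.Propositional.Properties using (∈-map⁻; ∈-tabulate⁻)
import Data.List.Relation.Unary.All as All
import Data.List.Relation.Unary.All.Properties as All
import Data.List.Relation.Unary.Unique.Propositional.Properties as Unique
open import Data.List.Relation.Binary.Pointwise using (Pointwise; []; _∷_)
import Data.List.Relation.Binary.Pointwise.Properties as Pointwise
open import Data.Product using (_,_; proj₁; proj₂; ∃; uncurry)
open import Data.Product.Properties using (,-injective)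
open import Data.Sum using (_⊎_; inj₁; inj₂; [_,_]′)
open import Data.Empty using (⊥-elim)
open import Data.Rational as ℚ using (ℚ)
import Data.Rational.Properties as ℚ
open import Data.Rational.Literals using (fromℤ)
import Data.Integer as ℤ
import Data.Integer.Properties as ℤ
open import Relation.Nullary using (Dec; yes; no)
open import Relation.Nullary.Decidable using (_×-dec_)
open import Relation.Binary.PropositionalEquality
open import Function using (_∘_)

-- Radix lists store every radix minus one: the digit lists of `rs` are the
-- lists bounded pointwise by `rs`, and every radix is positive.
Π : List ℕ → ℕ
Π []       = 1
Π (r ∷ rs) = suc r * Π rs

Digits : List ℕ → List ℕ → Set
Digits rs ds = Pointwise _≤_ ds rs

lexRank : List ℕ → List ℕ → ℕ
lexRank (r ∷ rs) (d ∷ ds) = Π rs * d + lexRank rs ds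
lexRank _        _        = 0

colexRank : List ℕ → List ℕ → ℕ
colexRank (r ∷ rs) (d ∷ ds) = suc r * colexRank rs ds + d
colexRank _        _        = 0

m*a≤m*b+x⇒a≤b : ∀ {m a b x} → x < m → m * a ≤ m * b + x → a ≤ b
m*a≤m*b+x⇒a≤b {m} {a} {b} {x} x<m le = s≤s⁻¹ (*-cancelˡ-< m a (suc b) (begin-strict
  m * a     ≤⟨ le ⟩
  m * b + x <⟨ +-monoʳ-< (m * b) x<m ⟩
  m * b + m ≡⟨ +-comm (m * b) m ⟩
  m + m * b ≡⟨ *-suc m b ⟨
  m * suc b ∎))
  where open ≤-Reasoning

m*d+x<[1+r]*m : ∀ {m d r x} → d ≤ r → x < m → m * d + x < suc r * m
m*d+x<[1+r]*m {m} {d} {r} {x} d≤r x<m = begin-strict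
  m * d + x <⟨ +-monoʳ-< (m * d) x<m ⟩
  m * d + m ≡⟨ +-comm (m * d) m ⟩
  m + m * d ≡⟨ *-suc m d ⟨
  m * suc d ≤⟨ *-monoʳ-≤ m (s≤s d≤r) ⟩
  m * suc r ≡⟨ *-comm m (suc r) ⟩
  suc r * m ∎
  where open ≤-Reasoning

lexRank<Π : ∀ {rs ds} → Digits rs ds → lexRank rs ds < Π rs
lexRank<Π []          = s≤s z≤n
lexRank<Π (d≤r ∷ ds) = m*d+x<[1+r]*m d≤r (lexRank<Π ds)

lexRank≤max : ∀ {rs ds} → Digits rs ds → lexRank rs ds ≤ lexRank rs rs
lexRank≤max []                   = z≤n
lexRank≤max {r ∷ rs} (d≤r ∷ ds) =
  +-mono-≤ (*-monoʳ-≤ (Π rs) d≤r) (lexRank≤max ds)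

colexRank-injective : ∀ {rs ds es} → Digits rs ds → Digits rs es →
                      colexRank rs ds ≡ colexRank rs es → ds ≡ es
colexRank-injective [] [] _ = refl
colexRank-injective {r ∷ rs} {d ∷ ds} {e ∷ es} (d≤r ∷ vd) (e≤r ∷ ve) eq =
  cong₂ _∷_ (+-cancelˡ-≡ _ d e (trans eq (cong (λ y → suc r * y + e) (sym ranks≡))))
            (colexRank-injective vd ve ranks≡)
  where
  ranks≡ : colexRank rs ds ≡ colexRank rs es
  ranks≡ = ≤-antisym
    (m*a≤m*b+x⇒a≤b (s≤s e≤r) (≤-trans (m≤m+n _ d) (≤-reflexive eq)))
    (m*a≤m*b+x⇒a≤b (s≤s d≤r) (≤-trans (m≤m+n _ e) (≤-reflexive (sym eq))))

digits : ∀ rs → Fin (Π rs) → List ℕ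
digits []       _ = []
digits (r ∷ rs) a = toℕ (proj₁ (remQuot {suc r} (Π rs) a)) ∷ digits rs (proj₂ (remQuot {suc r} (Π rs) a))

digits-valid : ∀ rs a → Digits rs (digits rs a)
digits-valid []       _ = []
digits-valid (r ∷ rs) a =
  s≤s⁻¹ (toℕ<n (proj₁ (remQuot {suc r} (Π rs) a))) ∷ digits-valid rs (proj₂ (remQuot {suc r} (Π rs) a))

lexRank-digits : ∀ rs a → lexRank rs (digits rs a) ≡ toℕ a
lexRank-digits []       Fin.zero = refl
lexRank-digits (r ∷ rs) a = begin
  Π rs * toℕ d + lexRank rs (digits rs a') ≡⟨ cong (Π rs * toℕ d +_) (lexRank-digits rs a') ⟩
  Π rs * toℕ d + toℕ a'                    ≡⟨ toℕ-combine d a' ⟨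
  toℕ (combine d a')                       ≡⟨ cong toℕ (combine-remQuot {suc r} (Π rs) a) ⟩
  toℕ a                                    ∎
  where
  open ≡-Reasoning
  d = proj₁ (remQuot {suc r} (Π rs) a)
  a' = proj₂ (remQuot {suc r} (Π rs) a)

digits-injective : ∀ rs {a a'} → digits rs a ≡ digits rs a' → a ≡ a'
digits-injective rs {a} {a'} eq = toℕ-injective (begin
  toℕ a                  ≡⟨ lexRank-digits rs a ⟨
  lexRank rs (digits rs a)  ≡⟨ cong (lexRank rs) eq ⟩
  lexRank rs (digits rs a') ≡⟨ lexRank-digits rs a' ⟩
  toℕ a'                 ∎)
  where open ≡-Reasoning

fromDigits : ∀ {rs ds} → Digits rs ds → Fin (Π rs)
fromDigits []         = Fin.zero
fromDigits (d≤r ∷ ds) = combine (fromℕ< (s≤s d≤r)) (fromDigits ds)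

digits-fromDigits : ∀ {rs ds} (v : Digits rs ds) → digits rs (fromDigits v) ≡ ds
digits-fromDigits [] = refl
digits-fromDigits {r ∷ rs} {d ∷ ds} (d≤r ∷ v) = begin
  toℕ (proj₁ (remQuot {suc r} (Π rs) c)) ∷ digits rs (proj₂ (remQuot {suc r} (Π rs) c))
    ≡⟨ cong (λ (x , y) → toℕ x ∷ digits rs y) (remQuot-combine (fromℕ< (s≤s d≤r)) (fromDigits v)) ⟩
  toℕ (fromℕ< (s≤s d≤r)) ∷ digits rs (fromDigits v)
    ≡⟨ cong₂ _∷_ (toℕ-fromℕ< (s≤s d≤r)) (digits-fromDigits v) ⟩
  d ∷ ds ∎
  where
  open ≡-Reasoning
  c = combine (fromℕ< (s≤s d≤r)) (fromDigits v)

remove : ∀ {A : Set} → ℕ → List A → List A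
remove _       []       = []
remove zero    (_ ∷ xs) = xs
remove (suc j) (x ∷ xs) = x ∷ remove j xs

Pointwise-remove : ∀ {A B : Set} {R : A → B → Set} {xs ys} j →
                   Pointwise R xs ys → Pointwise R (remove j xs) (remove j ys)
Pointwise-remove _       []         = []
Pointwise-remove zero    (_ ∷ xys)  = xys
Pointwise-remove (suc j) (xy ∷ xys) = xy ∷ Pointwise-remove j xys

remove-replicate : ∀ {A : Set} {x : A} {j k} → j < k → remove j (replicate k x) ≡ replicate (pred k) x
remove-replicate {j = zero}  {suc k}     _          = refl
remove-replicate {x = x} {j = suc j} {suc (suc k)} (s≤s j<k) = cong (x ∷_) (remove-replicate j<k)

≡-by-removals : ∀ {A : Set} {j j'} {xs ys : List A} → j ≢ j' →
                remove j xs ≡ remove j ys → remove j' xs ≡ remove j' ys → xs ≡ ys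
≡-by-removals {j = zero}  {zero}  j≢j' _ _ = ⊥-elim (j≢j' refl)
≡-by-removals {xs = []}     {[]}     _ _ _ = refl
≡-by-removals {j = suc _} {xs = []}     {_ ∷ _} _ () _
≡-by-removals {j = suc _} {xs = _ ∷ _}  {[]}    _ () _
≡-by-removals {j = zero} {suc _} {xs = []}    {_ ∷ _} _ _ ()
≡-by-removals {j = zero} {suc _} {xs = _ ∷ _} {[]}    _ _ ()
≡-by-removals {j = zero} {suc _} {xs = _ ∷ _} {_ ∷ _} _ tails heads =
  cong₂ _∷_ (proj₁ (∷-injective heads)) tails
≡-by-removals {j = suc _} {zero} {xs = _ ∷ _} {_ ∷ _} _ heads tails =
  cong₂ _∷_ (proj₁ (∷-injective heads)) tails
≡-by-removals {j = suc _} {suc _} {xs = _ ∷ _} {_ ∷ _} j≢j' eq eq' =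
  cong₂ _∷_ (proj₁ (∷-injective eq))
            (≡-by-removals (j≢j' ∘ cong suc) (proj₂ (∷-injective eq)) (proj₂ (∷-injective eq')))

-- The lines of the grid in direction j are indexed by the digit lists ℓ of
-- `remove j rs`, and p lies on the line ℓ iff remove j p ≡ ℓ.  Its points agree
-- with ℓ before position j, so their lexicographic ranks lie in
-- [lexLo, lexHi]; they agree after position j, so their colexicographic ranks
-- lie in [colexLo, colexHi].
lexLo : ℕ → List ℕ → List ℕ → ℕ
lexLo (suc j) (r ∷ rs) (d ∷ ℓ) = Π rs * d + lexLo j rs ℓ
lexLo _       _        _       = 0

lexHi : ℕ → List ℕ → List ℕ → ℕ
lexHi zero    rs       _       = lexRank rs rs
lexHi (suc j) (r ∷ rs) (d ∷ ℓ) = Π rs * d + lexHi j rs ℓ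
lexHi _       _        _       = 0

colexLo : ℕ → List ℕ → List ℕ → ℕ
colexLo zero    (r ∷ rs) ℓ       = suc r * colexRank rs ℓ
colexLo (suc j) (r ∷ rs) (_ ∷ ℓ) = suc r * colexLo j rs ℓ
colexLo _       _        _       = 0

colexHi : ℕ → List ℕ → List ℕ → ℕ
colexHi zero    (r ∷ rs) ℓ       = suc r * colexRank rs ℓ + r
colexHi (suc j) (r ∷ rs) (_ ∷ ℓ) = suc r * colexHi j rs ℓ + r
colexHi _       _        _       = 0

lexHi<Π : ∀ j {rs ℓ} → Digits (remove j rs) ℓ → lexHi j rs ℓ < Π rs
lexHi<Π zero    {rs}     _          = lexRank<Π (Pointwise.refl ≤-refl {rs})
lexHi<Π (suc j) {[]}     []         = s≤s z≤n
lexHi<Π (suc j) {r ∷ rs} (d≤r ∷ ℓ) = m*d+x<[1+r]*m d≤r (lexHi<Π j ℓ)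

lexLo≤lexRank : ∀ j {rs p} → Digits rs p → lexLo j rs (remove j p) ≤ lexRank rs p
lexLo≤lexRank zero    _       = z≤n
lexLo≤lexRank (suc j) []      = z≤n
lexLo≤lexRank (suc j) (_ ∷ p) = +-monoʳ-≤ _ (lexLo≤lexRank j p)

lexRank≤lexHi : ∀ j {rs p} → Digits rs p → lexRank rs p ≤ lexHi j rs (remove j p)
lexRank≤lexHi zero    p       = lexRank≤max p
lexRank≤lexHi (suc j) []      = z≤n
lexRank≤lexHi (suc j) (_ ∷ p) = +-monoʳ-≤ _ (lexRank≤lexHi j p)

colexLo≤colexRank : ∀ j {rs p} → Digits rs p → colexLo j rs (remove j p) ≤ colexRank rs p
colexLo≤colexRank zero    []      = z≤n
colexLo≤colexRank (suc j) []      = z≤n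
colexLo≤colexRank zero    (_ ∷ _) = m≤m+n _ _
colexLo≤colexRank (suc j) {r ∷ _} (_ ∷ p) = ≤-trans (*-monoʳ-≤ (suc r) (colexLo≤colexRank j p)) (m≤m+n _ _)

colexRank≤colexHi : ∀ j {rs p} → Digits rs p → colexRank rs p ≤ colexHi j rs (remove j p)
colexRank≤colexHi zero    []      = z≤n
colexRank≤colexHi (suc j) []      = z≤n
colexRank≤colexHi zero    (d≤r ∷ _) = +-monoʳ-≤ _ d≤r
colexRank≤colexHi (suc j) {r ∷ _} (d≤r ∷ p) = +-mono-≤ (*-monoʳ-≤ (suc r) (colexRank≤colexHi j p)) d≤r

inBlocks⇒onLine : ∀ j {rs p ℓ} → Digits rs p → Digits (remove j rs) ℓ →
  lexLo j rs ℓ ≤ lexRank rs p → lexRank rs p ≤ lexHi j rs ℓ →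
  colexLo j rs ℓ ≤ colexRank rs p → colexRank rs p ≤ colexHi j rs ℓ →
  remove j p ≡ ℓ
inBlocks⇒onLine _ [] [] _ _ _ _ = refl
inBlocks⇒onLine zero {r ∷ rs} {d ∷ ds} {ℓ} (d≤r ∷ p) v _ _ clo chi =
  colexRank-injective p v (≤-antisym
    (m*a≤m*b+x⇒a≤b (n<1+n r) (≤-trans (m≤m+n _ d) chi))
    (m*a≤m*b+x⇒a≤b (s≤s d≤r) clo))
inBlocks⇒onLine (suc j) {r ∷ rs} {d ∷ ds} (d≤r ∷ p) (_ ∷ v) llo lhi clo chi
  with refl ← ≤-antisym (m*a≤m*b+x⇒a≤b (lexRank<Π p) (≤-trans (m≤m+n _ _) llo))
                        (m*a≤m*b+x⇒a≤b (lexHi<Π j v) (≤-trans (m≤m+n _ _) lhi))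
  = cong (d ∷_) (inBlocks⇒onLine j p v
      (+-cancelˡ-≤ _ _ _ llo) (+-cancelˡ-≤ _ _ _ lhi)
      (m*a≤m*b+x⇒a≤b (s≤s d≤r) clo) (m*a≤m*b+x⇒a≤b (n<1+n r) (≤-trans (m≤m+n _ d) chi)))

Box : ℕ → Set
Box m = (Fin m → ℕ) × (Fin m → ℕ)

InsideAt : ∀ {m} → Box m → Box m → Fin m → Set
InsideAt (lo , hi) (lo' , hi') i = lo' i ≤ lo i × hi i ≤ hi' i

insideAt? : ∀ {m} (b b' : Box m) i → Dec (InsideAt b b' i)
insideAt? (lo , hi) (lo' , hi') i = (lo' i ≤? lo i) ×-dec (hi i ≤? hi' i)

_⊆ᵇ_ : ∀ {m} → Box m → Box m → Set
b ⊆ᵇ b' = ∀ i → InsideAt b b' i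

_⊈ᵇ_ : ∀ {m} → Box m → Box m → Set
(lo , hi) ⊈ᵇ (lo' , hi') = ∃ λ i → lo i < lo' i ⊎ hi' i < hi i

⊆ᵇ-or-⊈ᵇ : ∀ {m} (b b' : Box m) → b ⊆ᵇ b' ⊎ b ⊈ᵇ b'
⊆ᵇ-or-⊈ᵇ {m} b@(lo , hi) b'@(lo' , hi') with all? (insideAt? b b')
... | yes b⊆b' = inj₁ b⊆b'
... | no b⊈b' with ¬∀⟶∃¬ m _ (insideAt? b b') b⊈b'
...   | i , ¬inside with lo' i ≤? lo i
...     | yes lo'≤lo = inj₂ (i , inj₂ (≰⇒> (¬inside ∘ (lo'≤lo ,_))))
...     | no  lo'≰lo = inj₂ (i , inj₁ (≰⇒> lo'≰lo))

pointBox : List ℕ → List ℕ → Box 2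
pointBox rs p = ranks , ranks
  where
  ranks : Fin 2 → ℕ
  ranks Fin.zero    = lexRank rs p
  ranks (Fin.suc _) = colexRank rs p

lineBox : ℕ → List ℕ → List ℕ → Box 2
lineBox j rs ℓ = lo , hi
  where
  lo hi : Fin 2 → ℕ
  lo Fin.zero    = lexLo j rs ℓ
  lo (Fin.suc _) = colexLo j rs ℓ
  hi Fin.zero    = lexHi j rs ℓ
  hi (Fin.suc _) = colexHi j rs ℓ

pointBox⊆lineBox : ∀ j {rs p} → Digits rs p → pointBox rs p ⊆ᵇ lineBox j rs (remove j p)
pointBox⊆lineBox j p Fin.zero    = lexLo≤lexRank j p , lexRank≤lexHi j p
pointBox⊆lineBox j p (Fin.suc _) = colexLo≤colexRank j p , colexRank≤colexHi j p

⊆ᵇ-lineBox⇒onLine : ∀ j {rs p ℓ} → Digits rs p → Digits (remove j rs) ℓ →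
                    pointBox rs p ⊆ᵇ lineBox j rs ℓ → remove j p ≡ ℓ
⊆ᵇ-lineBox⇒onLine j p ℓ p⊆ℓ =
  inBlocks⇒onLine j p ℓ (proj₁ (p⊆ℓ Fin.zero)) (proj₂ (p⊆ℓ Fin.zero))
                        (proj₁ (p⊆ℓ (Fin.suc Fin.zero))) (proj₂ (p⊆ℓ (Fin.suc Fin.zero)))

ι : ℕ → ℚ
ι n = fromℤ (ℤ.+ n)

ι-mono-≤ : ∀ {a b} → a ≤ b → ι a ℚ.≤ ι b
ι-mono-≤ {a} {b} a≤b =
  ℚ.*≤* (subst₂ ℤ._≤_ (sym (ℤ.*-identityʳ (ℤ.+ a))) (sym (ℤ.*-identityʳ (ℤ.+ b))) (ℤ.+≤+ a≤b))

ι-mono-< : ∀ {a b} → a < b → ι a ℚ.< ι b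
ι-mono-< {a} {b} a<b =
  ℚ.*<* (subst₂ ℤ._<_ (sym (ℤ.*-identityʳ (ℤ.+ a))) (sym (ℤ.*-identityʳ (ℤ.+ b))) (ℤ.+<+ a<b))

BoxesDisjoint-sym : ∀ {d} {x y x' y' : Point d} → BoxesDisjoint x y x' y' → BoxesDisjoint x' y' x y
BoxesDisjoint-sym disjoint (z , z∈ , z∈') = disjoint (z , z∈' , z∈)

ι-BoxesDisjoint : ∀ {d} (x y x' y' : Fin d → ℕ) i → x i ⊔ y i < x' i ⊓ y' i →
                  BoxesDisjoint (ι ∘ x) (ι ∘ y) (ι ∘ x') (ι ∘ y')
ι-BoxesDisjoint x y x' y' i below (z , z∈ , z∈') = ℚ.<-irrefl refl (begin-strict
  z i                     ≤⟨ proj₂ (z∈ i) ⟩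
  ι (x i) ℚ.⊔ ι (y i)     ≤⟨ ℚ.⊔-lub (ι-mono-≤ (m≤m⊔n (x i) (y i))) (ι-mono-≤ (m≤n⊔m (x i) (y i))) ⟩
  ι (x i ⊔ y i)           <⟨ ι-mono-< below ⟩
  ι (x' i ⊓ y' i)         ≤⟨ ℚ.⊓-glb (ι-mono-≤ (m⊓n≤m (x' i) (y' i))) (ι-mono-≤ (m⊓n≤n (x' i) (y' i))) ⟩
  ι (x' i) ℚ.⊓ ι (y' i)   ≤⟨ proj₁ (z∈' i) ⟩
  z i                     ∎)
  where open ℚ.≤-Reasoning

⊔<⊓ : ∀ {a b c d} → a < c → a < d → b < c → b < d → a ⊔ b < c ⊓ d
⊔<⊓ a<c a<d b<c b<d = ⊓-glb (⊔-lub a<c b<c) (⊔-lub a<d b<d)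

module BoxCornerEmbedding {V m : ℕ} (box : Fin V → Box m) where

  corners : Fin V → Fin (m + m) → ℕ
  corners w = [ proj₁ (box w) , proj₂ (box w) ]′ ∘ splitAt m

  embedding : Fin V → Point (m + m)
  embedding w = ι ∘ corners w

  private
    corner : Fin m ⊎ Fin m → Fin V → ℕ
    corner s w = [ proj₁ (box w) , proj₂ (box w) ]′ s

    disjoint-at : ∀ {u v u' v'} c s → splitAt m c ≡ s →
      corner s u ⊔ corner s v < corner s u' ⊓ corner s v' →
      BoxesDisjoint (embedding u) (embedding v) (embedding u') (embedding v')
    disjoint-at {u} {v} {u'} {v'} c s refl =
      ι-BoxesDisjoint (corners u) (corners v) (corners u') (corners v') c

  -- For edges uv and u'v' with nested boxes, if the box of u leaves that of v'
  -- below (above) in coordinate i, the lower (upper) corners separate the edges.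
  ⊈ᵇ⇒BoxesDisjoint : ∀ {u v u' v'} → box u ⊆ᵇ box v → box u' ⊆ᵇ box v' → box u ⊈ᵇ box v' →
    BoxesDisjoint (embedding u) (embedding v) (embedding u') (embedding v')
  ⊈ᵇ⇒BoxesDisjoint uv u'v' (i , inj₁ lo<lo') =
    disjoint-at (i ↑ˡ m) (inj₁ i) (splitAt-↑ˡ m i m)
      (⊔<⊓ (<-≤-trans lo<lo' (proj₁ (u'v' i))) lo<lo'
           (≤-<-trans (proj₁ (uv i)) (<-≤-trans lo<lo' (proj₁ (u'v' i))))
           (≤-<-trans (proj₁ (uv i)) lo<lo'))
  ⊈ᵇ⇒BoxesDisjoint uv u'v' (i , inj₂ hi'<hi) = BoxesDisjoint-sym (
    disjoint-at (m ↑ʳ i) (inj₂ i) (splitAt-↑ʳ m m i)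
      (⊔<⊓ (≤-<-trans (proj₂ (u'v' i)) hi'<hi)
           (≤-<-trans (proj₂ (u'v' i)) (<-≤-trans hi'<hi (proj₂ (uv i))))
           hi'<hi
           (<-≤-trans hi'<hi (proj₂ (uv i)))))

  embedding-separating : ∀ (G : Graph V) →
    (∀ {e} → e ∈ edges G → box (proj₁ e) ⊆ᵇ box (proj₂ e)) →
    (∀ {e e'} → e ∈ edges G → e' ∈ edges G → EdgesDisjoint e e' →
       box (proj₁ e) ⊈ᵇ box (proj₂ e') ⊎ box (proj₁ e') ⊈ᵇ box (proj₂ e)) →
    Separating G (m + m) embedding
  embedding-separating G nested escapes e∈ e'∈ disjoint with escapes e∈ e'∈ disjoint
  ... | inj₁ out = ⊈ᵇ⇒BoxesDisjoint (nested e∈) (nested e'∈) out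
  ... | inj₂ out = BoxesDisjoint-sym (⊈ᵇ⇒BoxesDisjoint (nested e'∈) (nested e∈) out)

SepDimAtMost-+ : ∀ {V d} (G : Graph V) e → SepDimAtMost G d → SepDimAtMost G (d + e)
SepDimAtMost-+ {d = d} G e (φ , separating) = φ' , separating'
  where
  φ' : _ → Point (d + e)
  φ' v = [ φ v , (λ _ → ℚ.0ℚ) ]′ ∘ splitAt d

  φ'-↑ˡ : ∀ v i → φ' v (i ↑ˡ e) ≡ φ v i
  φ'-↑ˡ v i = cong [ φ v , (λ _ → ℚ.0ℚ) ]′ (splitAt-↑ˡ d i e)

  restrict : ∀ {u v z} → InBox (φ' u) (φ' v) z → InBox (φ u) (φ v) (z ∘ (_↑ˡ e))
  restrict {u} {v} {z} z∈ i =
    subst₂ (λ a b → (a ℚ.⊓ b ℚ.≤ z (i ↑ˡ e)) × (z (i ↑ˡ e) ℚ.≤ a ℚ.⊔ b))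
           (φ'-↑ˡ u i) (φ'-↑ˡ v i) (z∈ (i ↑ˡ e))

  separating' : Separating G (d + e) φ'
  separating' e∈ e'∈ disjoint (z , z∈ , z∈') =
    separating e∈ e'∈ disjoint (z ∘ (_↑ˡ e) , restrict z∈ , restrict z∈')

module _ {V n : ℕ} (V≤n : V ≤ n) where

  private
    inject : Fin V → Fin n
    inject u = inject≤ u V≤n

    injectEdge : Fin V × Fin V → Fin n × Fin n
    injectEdge (u , v) = inject u , inject v

    inject-injective : ∀ {u v} → inject u ≡ inject v → u ≡ v
    inject-injective = inject≤-injective V≤n V≤n _ _

    injectEdge-injective : ∀ {e e'} → injectEdge e ≡ injectEdge e' → e ≡ e'
    injectEdge-injective eq with ,-injective eq
    ... | eq₁ , eq₂ = cong₂ _,_ (inject-injective eq₁) (inject-injective eq₂)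

    EdgesDisjoint-injectEdge : ∀ {u v u' v'} → EdgesDisjoint (injectEdge (u , v)) (injectEdge (u' , v')) →
                               EdgesDisjoint (u , v) (u' , v')
    EdgesDisjoint-injectEdge (uu' , uv' , vu' , vv') =
      uu' ∘ cong inject , uv' ∘ cong inject , vu' ∘ cong inject , vv' ∘ cong inject

    inject-< : ∀ {e} → toℕ (proj₁ e) < toℕ (proj₂ e) →
               toℕ (proj₁ (injectEdge e)) < toℕ (proj₂ (injectEdge e))
    inject-< {u , v} = subst₂ _<_ (sym (toℕ-inject≤ u V≤n)) (sym (toℕ-inject≤ v V≤n))

  addVertices : Graph V → Graph n
  addVertices G = record
    { edges   = map injectEdge (edges G)
    ; ordered = All.map⁺ (All.map inject-< (ordered G))
    ; unique  = Unique.map⁺ injectEdge-injective (unique G)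
    }

  numEdges-addVertices : ∀ G → numEdges (addVertices G) ≡ numEdges G
  numEdges-addVertices G = length-map injectEdge (edges G)

  SepDimAtMost-addVertices : ∀ G {d} → SepDimAtMost G d → SepDimAtMost (addVertices G) d
  SepDimAtMost-addVertices G {d} (φ , separating) = φ' , separating'
    where
    φ' : Fin n → Point d
    φ' w with toℕ w <? V
    ... | yes w<V = φ (fromℕ< w<V)
    ... | no  _   = λ _ → ℚ.0ℚ

    φ'-inject : ∀ u → φ' (inject u) ≡ φ u
    φ'-inject u with toℕ (inject u) <? V
    ... | yes u<V = cong φ (toℕ-injective (trans (toℕ-fromℕ< u<V) (toℕ-inject≤ u V≤n)))
    ... | no  u≮V = ⊥-elim (u≮V (subst (_< V) (sym (toℕ-inject≤ u V≤n)) (toℕ<n u)))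

    separating' : Separating (addVertices G) d φ'
    separating' e∈ e'∈ disjoint with ∈-map⁻ injectEdge e∈ | ∈-map⁻ injectEdge e'∈
    ... | (u , v) , uv∈ , refl | (u' , v') , u'v'∈ , refl
      rewrite φ'-inject u | φ'-inject v | φ'-inject u' | φ'-inject v' =
      separating uv∈ u'v'∈ (EdgesDisjoint-injectEdge disjoint)

-- Lines run only in the k directions of radix t; the digit of radix q just
-- lets the number of points be tuned to n.
module GridIncidence (q' t' k : ℕ) where

  R Rₗ : List ℕ
  R  = q' ∷ replicate k t'
  Rₗ = q' ∷ replicate (pred k) t'

  P M V : ℕ
  P = Π R
  M = Π Rₗ
  V = P + k * M

  point : Fin P → List ℕ
  point = digits R

  direction : Fin k → ℕ
  direction J = suc (toℕ J)

  lineDigits-valid : ∀ J a → Digits Rₗ (remove (direction J) (point a))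
  lineDigits-valid J a = subst (λ rs → Digits rs (remove (direction J) (point a)))
                         (cong (q' ∷_) (remove-replicate (toℕ<n J)))
                         (Pointwise-remove (direction J) (digits-valid R a))

  lineThrough : Fin k → Fin P → Fin M
  lineThrough J a = fromDigits (lineDigits-valid J a)

  digits-lineThrough : ∀ J a → digits Rₗ (lineThrough J a) ≡ remove (direction J) (point a)
  digits-lineThrough J a = digits-fromDigits (lineDigits-valid J a)

  pointVertex : Fin P → Fin V
  pointVertex a = a ↑ˡ k * M

  lineVertex : Fin k → Fin M → Fin V
  lineVertex J c = P ↑ʳ combine J c

  private
    boxOf : Fin P ⊎ Fin (k * M) → Box 2
    boxOf = [ pointBox R ∘ point , (λ (J , c) → lineBox (direction J) R (digits Rₗ c)) ∘ remQuot M ]′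

  box : Fin V → Box 2
  box = boxOf ∘ splitAt P

  box-pointVertex : ∀ a → box (pointVertex a) ≡ pointBox R (point a)
  box-pointVertex a = cong boxOf (splitAt-↑ˡ P a (k * M))

  box-lineVertex : ∀ J c → box (lineVertex J c) ≡ lineBox (direction J) R (digits Rₗ c)
  box-lineVertex J c = trans (cong boxOf (splitAt-↑ʳ P (k * M) (combine J c)))
                             (cong (λ (J , c) → lineBox (direction J) R (digits Rₗ c)) (remQuot-combine J c))

  incidence : Fin k × Fin P → Fin V × Fin V
  incidence (J , a) = pointVertex a , lineVertex J (lineThrough J a)

  incidence-ordered : ∀ Ja → toℕ (proj₁ (incidence Ja)) < toℕ (proj₂ (incidence Ja))
  incidence-ordered (J , a) = begin-strict
    toℕ (a ↑ˡ k * M)           ≡⟨ toℕ-↑ˡ a (k * M) ⟩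
    toℕ a                      <⟨ toℕ<n a ⟩
    P                          ≤⟨ m≤m+n P _ ⟩
    P + toℕ (combine J _)      ≡⟨ toℕ-↑ʳ P (combine J _) ⟨
    toℕ (P ↑ʳ combine J _)     ∎
    where open ≤-Reasoning

  incidence-injective : ∀ {Ja Ja'} → incidence Ja ≡ incidence Ja' → Ja ≡ Ja'
  incidence-injective {J , a} {J' , a'} eq with ,-injective eq
  ... | u≡u' , v≡v' = cong₂ _,_
    (combine-injectiveˡ J _ J' _ (↑ʳ-injective P _ _ v≡v'))
    (↑ˡ-injective (k * M) a a' u≡u')

  graph : Graph V
  graph = record
    { edges   = tabulate (incidence ∘ remQuot P)
    ; ordered = All.tabulate⁺ (incidence-ordered ∘ remQuot P)
    ; unique  = Unique.tabulate⁺ (remQuot-injective ∘ incidence-injective)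
    }
    where
    remQuot-injective : ∀ {i i'} → remQuot {k} P i ≡ remQuot P i' → i ≡ i'
    remQuot-injective {i} {i'} eq = begin
      i                                   ≡⟨ combine-remQuot {k} P i ⟨
      uncurry combine (remQuot {k} P i)   ≡⟨ cong (uncurry combine) eq ⟩
      uncurry combine (remQuot {k} P i')  ≡⟨ combine-remQuot {k} P i' ⟩
      i'                                  ∎
      where open ≡-Reasoning

  numEdges-graph : numEdges graph ≡ k * P
  numEdges-graph = length-tabulate (incidence ∘ remQuot P)

  incidence-nested : ∀ Ja → box (proj₁ (incidence Ja)) ⊆ᵇ box (proj₂ (incidence Ja))
  incidence-nested (J , a) = subst₂ _⊆ᵇ_ (sym (box-pointVertex a)) (sym (box-lineVertex J _))
    (subst (λ ℓ → pointBox R (point a) ⊆ᵇ lineBox (direction J) R ℓ) (sym (digits-lineThrough J a))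
           (pointBox⊆lineBox (direction J) (digits-valid R a)))

  ⊆ᵇ-lineThrough⇒onLine : ∀ {a J' a'} →
    box (pointVertex a) ⊆ᵇ box (lineVertex J' (lineThrough J' a')) →
    remove (direction J') (point a) ≡ remove (direction J') (point a')
  ⊆ᵇ-lineThrough⇒onLine {a} {J'} {a'} a⊆ℓ = trans
    (⊆ᵇ-lineBox⇒onLine (direction J') (digits-valid R a) ℓ-valid
       (subst₂ _⊆ᵇ_ (box-pointVertex a) (box-lineVertex J' _) a⊆ℓ))
    (digits-lineThrough J' a')
    where
    ℓ-valid : Digits (remove (direction J') R) (digits Rₗ (lineThrough J' a'))
    ℓ-valid = subst (Digits _) (sym (digits-lineThrough J' a'))
                    (Pointwise-remove (direction J') (digits-valid R a'))

  -- If each point of two disjoint incidences lay on the other's line, two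
  -- distinct points would share two distinct lines.
  incidences-escape : ∀ Ja Ja' → EdgesDisjoint (incidence Ja) (incidence Ja') →
    box (proj₁ (incidence Ja)) ⊈ᵇ box (proj₂ (incidence Ja')) ⊎
    box (proj₁ (incidence Ja')) ⊈ᵇ box (proj₂ (incidence Ja))
  incidences-escape (J , a) (J' , a') (u≢u' , _ , _ , v≢v')
    with ⊆ᵇ-or-⊈ᵇ (box (pointVertex a)) (box (lineVertex J' (lineThrough J' a')))
       | ⊆ᵇ-or-⊈ᵇ (box (pointVertex a')) (box (lineVertex J (lineThrough J a)))
  ... | inj₂ out | _        = inj₁ out
  ... | inj₁ _   | inj₂ out = inj₂ out
  ... | inj₁ a∈ℓ' | inj₁ a'∈ℓ with J Fin.≟ J'
  ...   | yes refl = ⊥-elim (v≢v' (cong (lineVertex J) (digits-injective Rₗ (begin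
    digits Rₗ (lineThrough J a)   ≡⟨ digits-lineThrough J a ⟩
    remove (direction J) (point a)  ≡⟨ ⊆ᵇ-lineThrough⇒onLine a'∈ℓ ⟨
    remove (direction J) (point a') ≡⟨ digits-lineThrough J a' ⟨
    digits Rₗ (lineThrough J a')  ∎))))
    where open ≡-Reasoning
  ...   | no J≢J' = ⊥-elim (u≢u' (cong pointVertex (digits-injective R
    (≡-by-removals (J≢J' ∘ toℕ-injective ∘ suc-injective)
                   (sym (⊆ᵇ-lineThrough⇒onLine a'∈ℓ)) (⊆ᵇ-lineThrough⇒onLine a∈ℓ')))))

  graph-SepDimAtMost : SepDimAtMost graph 4
  graph-SepDimAtMost = embedding , embedding-separating graph nested escapes
    where
    open BoxCornerEmbedding box

    nested : ∀ {e} → e ∈ edges graph → box (proj₁ e) ⊆ᵇ box (proj₂ e)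
    nested e∈ with ∈-tabulate⁻ e∈
    ... | i , refl = incidence-nested (remQuot P i)

    escapes : ∀ {e e'} → e ∈ edges graph → e' ∈ edges graph → EdgesDisjoint e e' →
              box (proj₁ e) ⊈ᵇ box (proj₂ e') ⊎ box (proj₁ e') ⊈ᵇ box (proj₂ e)
    escapes e∈ e'∈ with ∈-tabulate⁻ e∈ | ∈-tabulate⁻ e'∈
    ... | i , refl | i' , refl = incidences-escape (remQuot P i) (remQuot P i')

Π-replicate : ∀ k r → Π (replicate k r) ≡ suc r ^ k
Π-replicate zero    r = refl
Π-replicate (suc k) r = cong (suc r *_) (Π-replicate k r)

Π-replicate-pred : ∀ {k r} → k ≤ suc r → k * Π (replicate (pred k) r) ≤ Π (replicate k r)
Π-replicate-pred {zero}      _   = z≤n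
Π-replicate-pred {suc k} {r} k≤r = *-monoˡ-≤ (Π (replicate k r)) k≤r

gridIncidenceGraph : ∀ {n} q t k .{{_ : NonZero q}} .{{_ : NonZero t}} → k ≤ t → 2 * (t ^ k * q) ≤ n →
                     Σ (Graph n) λ G → numEdges G ≡ k * (t ^ k * q) × SepDimAtMost G 6
gridIncidenceGraph {n} q t k k≤t 2P≤n =
  addVertices V≤n graph ,
  trans (numEdges-addVertices V≤n graph) (trans numEdges-graph (cong (k *_) P≡)) ,
  SepDimAtMost-addVertices V≤n graph (SepDimAtMost-+ graph 2 graph-SepDimAtMost)
  where
  open GridIncidence (pred q) (pred t) k

  P≡ : P ≡ t ^ k * q
  P≡ = trans (cong₂ _*_ (suc-pred q) (trans (Π-replicate k (pred t)) (cong (_^ k) (suc-pred t))))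
             (*-comm q (t ^ k))

  kM≤P : k * M ≤ P
  kM≤P = begin
    k * (suc (pred q) * Π (replicate (pred k) (pred t)))  ≡⟨ x∙yz≈y∙xz k (suc (pred q)) _ ⟩
    suc (pred q) * (k * Π (replicate (pred k) (pred t)))  ≤⟨ *-monoʳ-≤ (suc (pred q))
                                                              (Π-replicate-pred (subst (k ≤_) (sym (suc-pred t)) k≤t)) ⟩
    suc (pred q) * Π (replicate k (pred t))               ∎
    where open ≤-Reasoning

  V≤n : P + k * M ≤ n
  V≤n = begin
    P + k * M     ≤⟨ +-monoʳ-≤ P kM≤P ⟩
    P + P         ≡⟨ cong (P +_) (+-identityʳ P) ⟨
    2 * P         ≡⟨ cong (2 *_) P≡ ⟩
    2 * (t ^ k * q) ≤⟨ 2P≤n ⟩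
    n             ∎
    where open ≤-Reasoning

≤⌊log₂⌋ : ∀ {a m} → 2 ^ a ≤ m → a ≤ ⌊log₂ m ⌋
≤⌊log₂⌋ {a} 2^a≤m = subst (_≤ _) (⌊log₂[2^n]⌋≡n a) (⌊log₂⌋-mono-≤ 2^a≤m)

<2^suc⌊log₂⌋ : ∀ m → m < 2 ^ suc ⌊log₂ m ⌋
<2^suc⌊log₂⌋ m with 2 ^ suc ⌊log₂ m ⌋ ≤? m
... | yes big = ⊥-elim (1+n≰n (≤⌊log₂⌋ big))
... | no  small = ≰⇒> small

2^⌊log₂⌋≤ : ∀ {m} → 1 ≤ m → 2 ^ ⌊log₂ m ⌋ ≤ m
2^⌊log₂⌋≤ 1≤m = go _ 1≤m refl
  where
  go : ∀ ℓ {m} → 1 ≤ m → ⌊log₂ m ⌋ ≡ ℓ → 2 ^ ℓ ≤ m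
  go zero    1≤m _ = 1≤m
  go (suc ℓ) {m} _ log≡ = begin
    2 * 2 ^ ℓ     ≤⟨ *-monoʳ-≤ 2 (go ℓ 1≤half (trans (⌊log₂⌊n/2⌋⌋≡⌊log₂n⌋∸1 m) (cong (_∸ 1) log≡))) ⟩
    2 * ⌊ m /2⌋   ≡⟨ cong (⌊ m /2⌋ +_) (+-identityʳ _) ⟩
    ⌊ m /2⌋ + ⌊ m /2⌋ ≤⟨ +-monoʳ-≤ ⌊ m /2⌋ (⌊n/2⌋≤⌈n/2⌉ m) ⟩
    ⌊ m /2⌋ + ⌈ m /2⌉ ≡⟨ ⌊n/2⌋+⌈n/2⌉≡n m ⟩
    m             ∎
    where
    open ≤-Reasoning
    2≤m : 2 ≤ m
    2≤m with 2 ≤? m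
    ... | yes 2≤m = 2≤m
    ... | no  m<2 = ⊥-elim (n≮0 (subst (_≤ 0) log≡ (⌊log₂⌋-mono-≤ (s≤s⁻¹ (≰⇒> m<2)))))
    1≤half : 1 ≤ ⌊ m /2⌋
    1≤half = ⌊n/2⌋-mono 2≤m

2*n≤2^n : ∀ n → 2 * n ≤ 2 ^ n
2*n≤2^n zero          = z≤n
2*n≤2^n (suc zero)    = ≤-refl
2*n≤2^n (suc (suc n)) = begin
  2 * suc (suc n)       ≡⟨ *-suc 2 (suc n) ⟩
  2 + 2 * suc n         ≤⟨ +-mono-≤ (*-monoʳ-≤ 2 (m^n>0 2 n)) (2*n≤2^n (suc n)) ⟩
  2 ^ suc n + 2 ^ suc n ≡⟨ cong (2 ^ suc n +_) (+-identityʳ _) ⟨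
  2 ^ suc (suc n)       ∎
  where open ≤-Reasoning

quotient-bounds : ∀ m d .{{_ : NonZero d}} → 2 * d ≤ m →
                  ∃ λ q → 1 ≤ q × 2 * (d * q) ≤ m × m ≤ 4 * (d * q)
quotient-bounds m d 2d≤m = q , 1≤q , 2dq≤m , m≤4dq
  where
  open ≤-Reasoning
  instance
    2d≢0 : NonZero (2 * d)
    2d≢0 = >-nonZero (≤-trans (>-nonZero⁻¹ d) (m≤n*m d 2))
  q = m / (2 * d)
  1≤q : 1 ≤ q
  1≤q = m≥n⇒m/n>0 2d≤m
  q[2d]≡2[dq] : q * (2 * d) ≡ 2 * (d * q)
  q[2d]≡2[dq] = trans (*-comm q (2 * d)) (*-assoc 2 d q)
  2dq≤m : 2 * (d * q) ≤ m
  2dq≤m = subst (_≤ m) q[2d]≡2[dq] (m/n*n≤m m (2 * d))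
  m≤4dq : m ≤ 4 * (d * q)
  m≤4dq = <⇒≤ (begin-strict
    m                           ≡⟨ m≡m%n+[m/n]*n m (2 * d) ⟩
    m % (2 * d) + q * (2 * d)   <⟨ +-monoˡ-< _ (m%n<n m (2 * d)) ⟩
    2 * d + q * (2 * d)         ≡⟨ cong (2 * d +_) q[2d]≡2[dq] ⟩
    2 * d + 2 * (d * q)         ≤⟨ +-monoˡ-≤ (2 * (d * q)) (*-monoʳ-≤ 2 (m≤m*n d q {{>-nonZero 1≤q}})) ⟩
    2 * (d * q) + 2 * (d * q)   ≡⟨ *-distribʳ-+ (d * q) 2 2 ⟨
    4 * (d * q)                 ∎)

-- The radix t = 2^s with s = ⌊log₂ L⌋ and k = ⌊L / 2s⌋ directions: k ≤ t
-- because 2sk ≤ L < 2^(s+1), and t^k ≤ 2^(L/2).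
gridShape : ∀ L → 2 ≤ L → ∃ λ t → ∃ λ k →
  1 ≤ t × k ≤ t × 2 * t ^ k ≤ 2 ^ L × L ≤ 4 * (⌊log₂ L ⌋ * k)
gridShape L 2≤L =
  let k , 1≤k , 2sk≤L , L≤4sk = quotient-bounds L s 2s≤L
  in 2 ^ s , k , m^n>0 2 s , k≤2^s 2sk≤L , 2[2^s]^k≤2^L 1≤k 2sk≤L , L≤4sk
  where
  open ≤-Reasoning
  s = ⌊log₂ L ⌋
  1≤s : 1 ≤ s
  1≤s = ≤⌊log₂⌋ 2≤L
  instance
    s≢0 : NonZero s
    s≢0 = >-nonZero 1≤s
  2s≤L : 2 * s ≤ L
  2s≤L = ≤-trans (2*n≤2^n s) (2^⌊log₂⌋≤ (≤-trans (s≤s z≤n) 2≤L))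

  k≤2^s : ∀ {k} → 2 * (s * k) ≤ L → k ≤ 2 ^ s
  k≤2^s {k} 2sk≤L = <⇒≤ (*-cancelˡ-< 2 k (2 ^ s) (begin-strict
    2 * k         ≤⟨ *-monoʳ-≤ 2 (m≤n*m k s) ⟩
    2 * (s * k)   ≤⟨ 2sk≤L ⟩
    L             <⟨ <2^suc⌊log₂⌋ L ⟩
    2 * 2 ^ s     ∎))

  2[2^s]^k≤2^L : ∀ {k} → 1 ≤ k → 2 * (s * k) ≤ L → 2 * (2 ^ s) ^ k ≤ 2 ^ L
  2[2^s]^k≤2^L {k} 1≤k 2sk≤L = begin
    2 * (2 ^ s) ^ k   ≡⟨ cong (2 *_) (^-*-assoc 2 s k) ⟩
    2 ^ suc (s * k)   ≤⟨ ^-monoʳ-≤ 2 1+sk≤L ⟩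
    2 ^ L             ∎
    where
    1+sk≤L : suc (s * k) ≤ L
    1+sk≤L = begin
      suc (s * k)     ≡⟨ +-comm 1 (s * k) ⟩
      s * k + 1       ≤⟨ +-monoʳ-≤ (s * k) (*-mono-≤ 1≤s 1≤k) ⟩
      s * k + s * k   ≡⟨ cong (s * k +_) (+-identityʳ (s * k)) ⟨
      2 * (s * k)     ≤⟨ 2sk≤L ⟩
      L               ∎

edgeCount-bound : ∀ {n L s k P} → n ≤ 4 * P → L ≤ 4 * (s * k) → n * L ≤ 16 * (k * P) * s
edgeCount-bound {n} {L} {s} {k} {P} n≤4P L≤4sk = begin
  n * L                   ≤⟨ *-mono-≤ n≤4P L≤4sk ⟩
  4 * P * (4 * (s * k))   ≡⟨ rearrange P s k ⟩
  16 * (k * P) * s        ∎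
  where
  open ≤-Reasoning
  rearrange : ∀ P s k → 4 * P * (4 * (s * k)) ≡ 16 * (k * P) * s
  rearrange = solve-∀

theorem9 : Σ ℕ λ k → (1 ≤ k) × Σ ℕ λ n₀ → (n : ℕ) → n ≥ n₀ →
             Σ (Graph n) λ G →
               (k * numEdges G * ⌊log₂ ⌊log₂ n ⌋ ⌋ ≥ n * ⌊log₂ n ⌋) × SepDimAtMost G 6
theorem9 = 16 , s≤s z≤n , 4 , dense
  where
  dense : ∀ n → n ≥ 4 → Σ (Graph n) λ G →
          (16 * numEdges G * ⌊log₂ ⌊log₂ n ⌋ ⌋ ≥ n * ⌊log₂ n ⌋) × SepDimAtMost G 6
  dense n 4≤n =
    let t , k , 1≤t , k≤t , 2tᵏ≤2ᴸ , L≤4sk = gridShape ⌊log₂ n ⌋ (≤⌊log₂⌋ {2} 4≤n)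
        q , 1≤q , 2P≤n , n≤4P = quotient-bounds n (t ^ k) {{m^n≢0 t k {{>-nonZero 1≤t}}}}
                                  (≤-trans 2tᵏ≤2ᴸ (2^⌊log₂⌋≤ (≤-trans (s≤s z≤n) 4≤n)))
        G , |G|≡kP , sepDim = gridIncidenceGraph q t k {{>-nonZero 1≤q}} {{>-nonZero 1≤t}} k≤t 2P≤n
    in G , subst (λ e → n * ⌊log₂ n ⌋ ≤ 16 * e * ⌊log₂ ⌊log₂ n ⌋ ⌋) (sym |G|≡kP)
                 (edgeCount-bound {k = k} {P = t ^ k * q} n≤4P L≤4sk) , sepDim
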